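{- For any $k\in\mathcal K$, $s\in S$ and $\ell\in\mathbb Z$: (1) if $k_\bullet+1-\ell$ is even, then $\theta^{(s)}_{k,\ell}=2s+2-k_0$; (2) if $k_\bullet+1-\ell$ is odd, then $\theta^{(s)}_{k,\ell}=p-1-2s+k_0$; (3) $3\le\theta^{(s)}_{k,\ell}\le p-2$; (4) as a function of $s\in S$, $B^{(s)}_{k,\ell}$ is increasing if $k_\bullet+1-\ell$ is even and decreasing if $k_\bullet+1-\ell$ is odd.
   Context: Let $p\ge7$ be prime, $k_0\in\{2,\dots,p\}$, $\mathcal K=\{k\ge2:k\equiv k_0\pmod{p-1}\}$, $k_\bullet=(k-k_0)/(p-1)$, $\{n\}\in\{0,\dots,p-2\}$ the residue mod $p-1$, $S=\{\lceil\frac{k_0+1}2\rceil,\dots,\lfloor\frac{k_0-4+p}2\rfloor\}$. For $s\in\{0,\dots,p-2\}$: $a_s=\{k_0-2-2s\}$; $\delta_s=0$ if $s+\{a_s+s\}<p-1$, else $1$; if $a_s+s<p-1$, $t_1^{(s)}=s+\delta_s$, $t_2^{(s)}=a_s+s+\delta_s+2$; otherwise $t_1^{(s)}=\{a_s+s\}+\delta_s+1$, $t_2^{(s)}=s+\delta_s+1$. For $n\in\mathbb Z$, $\beta^{(s)}_n=t_1^{(s)}$ if $n$ is even and $\beta^{(s)}_n=t_2^{(s)}-\frac{p+1}2$ if $n$ is odd. For $\ell\in\mathbb Z$: $\theta^{(s)}_{k,\ell}=\beta^{(s)}_{k_\bullet-\delta_s-\ell}-\beta^{(s)}_{k_\bullet+1-\delta_s-\ell}+\frac{p+1}2$,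 $A^{(s)}_{k,\ell}=\frac12\big(k-2-(p+1)\ell+\theta^{(s)}_{k,\ell+1}\big)$, $B^{(s)}_{k,\ell}=\frac12\big(k-2+(p+1)\ell-\theta^{(s)}_{k,\ell+1}\big)$. -}

module Defs where

open import Data.Nat as ℕ using (ℕ; zero; suc; _∸_)
open import Data.Integer as ℤ using (ℤ; +_; _+_; _-_; _*_; _%ℕ_; _/ℕ_)
open import Data.Integer.Divisibility using (_∣_)
open import Data.Rational.Unnormalised using (ℚᵘ; mkℚᵘ)
open import Data.Product using (_×_)
open import Data.Bool using (Bool; true; false; if_then_else_)

-- p - 1, written as suc (p ∸ 2) so that it is syntactically nonzero;
-- equals p - 1 for every p ≥ 2 (in particular for p ≥ 7).
pm1 : ℕ → ℕ
pm1 p = suc (p ∸ 2)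

res : ℕ → ℤ → ℕ
res p n = n %ℕ pm1 p

-- (p+1)/2 as an integer (exact since p is odd)
halfp1 : ℕ → ℤ
halfp1 p = + ((p ℕ.+ 1) ℕ./ 2)

Even : ℤ → Set
Even n = + 2 ∣ n

Odd : ℤ → Set
Odd n = Even n → Data.Empty.⊥
  where import Data.Empty

isEven : ℤ → Bool
isEven n = (n %ℕ 2) ℕ.≡ᵇ 0

InK : ℕ → ℕ → ℕ → Set
InK p k0 k = (2 ℕ.≤ k) × ((+ pm1 p) ∣ (+ k - + k0))

-- k• = (k - k₀)/(p - 1)  (exact division for k ∈ 𝒦)
kb : ℕ → ℕ → ℕ → ℤ
kb p k0 k = (+ k - + k0) /ℕ pm1 p

-- membership in S = {⌈(k₀+1)/2⌉, …, ⌊(k₀-4+p)/2⌋}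
-- ⌈(k₀+1)/2⌉ = ⌊(k₀+2)/2⌋ ; k₀ - 4 + p ≥ 0 since p ≥ 7.
InS : ℕ → ℕ → ℕ → Set
InS p k0 s = ((k0 ℕ.+ 2) ℕ./ 2 ℕ.≤ s) × (s ℕ.≤ (k0 ℕ.+ p ∸ 4) ℕ./ 2)

a : ℕ → ℕ → ℕ → ℕ
a p k0 s = res p (+ k0 - + 2 - + (2 ℕ.* s))

δ : ℕ → ℕ → ℕ → ℕ
δ p k0 s = if (s ℕ.+ res p (+ (a p k0 s ℕ.+ s))) ℕ.<ᵇ pm1 p then 0 else 1

t₁ : ℕ → ℕ → ℕ → ℕ
t₁ p k0 s = if (a p k0 s ℕ.+ s) ℕ.<ᵇ pm1 p
            then s ℕ.+ δ p k0 s
            else res p (+ (a p k0 s ℕ.+ s)) ℕ.+ δ p k0 s ℕ.+ 1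

t₂ : ℕ → ℕ → ℕ → ℕ
t₂ p k0 s = if (a p k0 s ℕ.+ s) ℕ.<ᵇ pm1 p
            then a p k0 s ℕ.+ s ℕ.+ δ p k0 s ℕ.+ 2
            else s ℕ.+ δ p k0 s ℕ.+ 1

β : ℕ → ℕ → ℕ → ℤ → ℤ
β p k0 s n = if isEven n then + t₁ p k0 s else + t₂ p k0 s - halfp1 p

θ : ℕ → ℕ → ℕ → ℕ → ℤ → ℤ
θ p k0 s k ℓ =
  β p k0 s (kb p k0 k - + δ p k0 s - ℓ)
  - β p k0 s (kb p k0 k + + 1 - + δ p k0 s - ℓ)
  + halfp1 p

-- A^{(s)}_{k,ℓ} and B^{(s)}_{k,ℓ} as rationals: mkℚᵘ n 1 denotes n / 2.
A : ℕ → ℕ → ℕ → ℕ → ℤ → ℚᵘ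
A p k0 s k ℓ = mkℚᵘ (+ k - + 2 - + (p ℕ.+ 1) * ℓ + θ p k0 s k (ℓ + + 1)) 1

B : ℕ → ℕ → ℕ → ℕ → ℤ → ℚᵘ
B p k0 s k ℓ = mkℚᵘ (+ k - + 2 + + (p ℕ.+ 1) * ℓ - θ p k0 s k (ℓ + + 1)) 1

-- Write δ = δ_s and x = k• − δ − ℓ.  Then θ_{k,ℓ} = β_x − β_{x+1} + (p+1)/2, which is t₂ − t₁
-- when x + 1 is even and (p + 1) − (t₂ − t₁) when it is odd, because p is odd.  For s ∈ S one
-- has a_s = p + k₀ − 3 − 2s.  If s ≥ k₀ − 1 then a_s + s < p − 1, δ = 1 and t₂ − t₁ = p − 1 − 2s + k₀;
-- if s ≤ k₀ − 2 then a_s + s wraps around modulo p − 1, δ = 0 and t₂ − t₁ = 2s + 2 − k₀.  The two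
-- values add up to p + 1, so in both regimes θ_{k,ℓ} is 2s + 2 − k₀ or p − 1 − 2s + k₀ according
-- to the parity of k• + 1 − ℓ, and 3 ≤ θ_{k,ℓ} ≤ p − 2 are exactly the two inequalities defining S.
-- Finally B_{k,ℓ} = (c − θ_{k,ℓ+1})/2 with c independent of s, and θ_{k,ℓ+1} is governed by the
-- parity of k• − ℓ, opposite to that of k• + 1 − ℓ.

module Submission where

open import Defs
open import Data.Nat as ℕ using (ℕ; suc; _≤_; _<_; s≤s)
open import Data.Nat.Primality using (Prime; composite)
open import Data.Integer as ℤ using (ℤ; +_; -[1+_]; _+_; _-_; _*_; -_; ∣_∣; _%ℕ_; _/ℕ_) renaming (_≤_ to _≤ℤ_)
open import Data.Rational.Unnormalised using (mkℚᵘ; *<*) renaming (_<_ to _<ℚ_)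
open import Data.Product using (_×_; _,_; proj₁; proj₂)
open import Data.Sum using (_⊎_; inj₁; inj₂)
open import Data.Bool using (true; false)
open import Data.Bool.Properties using (if-cong)
open import Data.Empty using (⊥-elim)
open import Relation.Nullary using (Dec; yes; no)
open import Relation.Nullary.Decidable using (dec-true; dec-false)
open import Relation.Binary.PropositionalEquality using (_≡_; refl; sym; trans; cong; cong₂; subst; subst₂; module ≡-Reasoning)
import Data.Nat.Properties as ℕ
import Data.Nat.DivMod as ℕ
import Data.Nat.Divisibility as ℕ
import Data.Integer.Properties as ℤ
import Data.Integer.DivMod as ℤ
import Data.Integer.Divisibility.Signed as Signed
open import Data.Integer.Tactic.RingSolver using (solve-∀)
import Data.Nat.Tactic.RingSolver as ℕ-Solver

-- Parity of integers

even? : ∀ n → Dec (Even n)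
even? n = 2 ℕ.∣? ∣ n ∣

even-suc⇒odd : ∀ n → Even (n + + 1) → Odd n
even-suc⇒odd n e+1 e with ℕ.∣1⇒≡1 (Signed.∣⇒∣ᵤ {+ 2} {+ 1} 2∣1)
  where
  2∣1 : + 2 Signed.∣ + 1
  2∣1 = Signed.∣m+n∣m⇒∣n (Signed.∣ᵤ⇒∣ {+ 2} {n + + 1} e+1) (Signed.∣ᵤ⇒∣ {+ 2} {n} e)
... | ()

isEven-spec : ∀ n → (isEven n ≡ true × Even n) ⊎ (isEven n ≡ false × Even (n + + 1))
isEven-spec n with n %ℕ 2 | ℤ.n%ℕd<d n 2 | ℤ.a≡a%ℕn+[a/ℕn]*n n 2
... | 0           | _               | n≡2q   = inj₁ (refl , Signed.∣⇒∣ᵤ (Signed.divides (n /ℕ 2) (trans n≡2q (ℤ.+-identityˡ _))))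
... | 1           | _               | n≡2q+1 = inj₂ (refl , Signed.∣⇒∣ᵤ (Signed.divides (n /ℕ 2 + + 1) n+1≡2[q+1]))
  where
  n+1≡2[q+1] : n + + 1 ≡ (n /ℕ 2 + + 1) * + 2
  n+1≡2[q+1] = trans (cong (_+ + 1) n≡2q+1) (shift (n /ℕ 2))
    where
    shift : ∀ q → + 1 + q * + 2 + + 1 ≡ (q + + 1) * + 2
    shift = solve-∀
... | suc (suc _) | s≤s (s≤s ()) | _

isEven-even : ∀ n → Even n → isEven n ≡ true
isEven-even n e with isEven-spec n
... | inj₁ (b , _)   = b
... | inj₂ (_ , e+1) = ⊥-elim (even-suc⇒odd n e+1 e)

isEven-odd : ∀ n → Odd n → isEven n ≡ false
isEven-odd n o with isEven-spec n
... | inj₁ (_ , e) = ⊥-elim (o e)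
... | inj₂ (b , _) = b

odd-suc⇒even : ∀ n → Odd (n + + 1) → Even n
odd-suc⇒even n o with isEven-spec n
... | inj₁ (_ , e)   = e
... | inj₂ (_ , e+1) = ⊥-elim (o e+1)

prime⇒odd : ∀ {p} → Prime p → 2 < p → p ℕ.% 2 ≡ 1
prime⇒odd {p} pr 2<p with p ℕ.% 2 | ℕ.m%n<n p 2 | ℕ.m≡m%n+[m/n]*n p 2
... | 0           | _              | p≡2q = ⊥-elim (Prime.notComposite pr (composite {2} 2<p (ℕ.divides (p ℕ./ 2) p≡2q)))
... | 1           | _              | _    = refl
... | suc (suc _) | s≤s (s≤s ()) | _

halfp1-odd : ∀ q → halfp1 (1 ℕ.+ q ℕ.* 2) + halfp1 (1 ℕ.+ q ℕ.* 2) ≡ + (1 ℕ.+ q ℕ.* 2) + + 1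
halfp1-odd q = cong +_ (begin
  h ℕ.+ h         ≡⟨ cong (λ m → m ℕ.+ m) h≡q+1 ⟩
  suc q ℕ.+ suc q ≡⟨ twice-suc q ⟩
  1 ℕ.+ q ℕ.* 2 ℕ.+ 1 ∎)
  where
  open ≡-Reasoning
  h : ℕ
  h = (1 ℕ.+ q ℕ.* 2 ℕ.+ 1) ℕ./ 2
  twice-suc : ∀ q → suc q ℕ.+ suc q ≡ 1 ℕ.+ q ℕ.* 2 ℕ.+ 1
  twice-suc = ℕ-Solver.solve-∀
  h≡q+1 : h ≡ suc q
  h≡q+1 = trans (cong (ℕ._/ 2) (ℕ.+-comm (1 ℕ.+ q ℕ.* 2) 1)) (ℕ.m*n/n≡m (suc q) 2)

halfp1-double : ∀ {p} → p ℕ.% 2 ≡ 1 → halfp1 p + halfp1 p ≡ + p + + 1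
halfp1-double {p} p%2≡1 = subst (λ m → halfp1 m + halfp1 m ≡ + m + + 1) (sym p≡1+2q) (halfp1-odd (p ℕ./ 2))
  where
  p≡1+2q : p ≡ 1 ℕ.+ p ℕ./ 2 ℕ.* 2
  p≡1+2q = trans (ℕ.m≡m%n+[m/n]*n p 2) (cong (ℕ._+ p ℕ./ 2 ℕ.* 2) p%2≡1)

m+n≡o⇒m≤o : ∀ {m n o} → m ℕ.+ n ≡ o → m ≤ o
m+n≡o⇒m≤o {m} {n} eq = subst (m ≤_) eq (ℕ.m≤m+n m n)

res-+pm1 : ∀ p {m} → m < pm1 p → res p (+ (m ℕ.+ pm1 p)) ≡ m
res-+pm1 p {m} m<d = trans (ℕ.[m+n]%n≡m%n m (pm1 p)) (ℕ.m<n⇒m%n≡m m<d)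

res-neg : ∀ p g x → suc g ℕ.+ suc x ≡ pm1 p → res p -[1+ g ] ≡ suc x
res-neg p g x eq rewrite ℕ.m<n⇒m%n≡m (m+n≡o⇒m≤o {suc (suc g)} {x} (trans (sym (ℕ.+-suc (suc g) x)) eq)) =
  trans (cong (ℕ._∸ suc g) (sym eq)) (ℕ.m+n∸m≡n (suc g) (suc x))

-- θ in terms of t₁ and t₂

module _ (p k0 s : ℕ) where

  β-even : ∀ n → Even n → β p k0 s n ≡ + t₁ p k0 s
  β-even n e = if-cong (isEven-even n e)

  β-odd : ∀ n → Odd n → β p k0 s n ≡ + t₂ p k0 s - halfp1 p
  β-odd n o = if-cong (isEven-odd n o)

  β-step≡t₂-t₁ : ∀ x y → y ≡ x + + 1 → Even y →
    β p k0 s x - β p k0 s y + halfp1 p ≡ + t₂ p k0 s - + t₁ p k0 s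
  β-step≡t₂-t₁ x y refl e = begin
    β p k0 s x - β p k0 s y + h ≡⟨ cong₂ (λ u v → u - v + h) (β-odd x (even-suc⇒odd x e)) (β-even y e) ⟩
    (+ t₂ p k0 s - h) - + t₁ p k0 s + h ≡⟨ cancel (+ t₁ p k0 s) (+ t₂ p k0 s) h ⟩
    + t₂ p k0 s - + t₁ p k0 s ∎
    where
    open ≡-Reasoning
    h : ℤ
    h = halfp1 p
    cancel : ∀ a b h → (b - h) - a + h ≡ b - a
    cancel = solve-∀

  β-step≡p+1-[t₂-t₁] : ∀ x y → halfp1 p + halfp1 p ≡ + p + + 1 → y ≡ x + + 1 → Odd y →
    β p k0 s x - β p k0 s y + halfp1 p ≡ + p + + 1 - (+ t₂ p k0 s - + t₁ p k0 s)
  β-step≡p+1-[t₂-t₁] x y 2h≡p+1 refl o = begin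
    β p k0 s x - β p k0 s y + h ≡⟨ cong₂ (λ u v → u - v + h) (β-even x (odd-suc⇒even x o)) (β-odd y o) ⟩
    + t₁ p k0 s - (+ t₂ p k0 s - h) + h ≡⟨ regroup (+ t₁ p k0 s) (+ t₂ p k0 s) h ⟩
    h + h - (+ t₂ p k0 s - + t₁ p k0 s) ≡⟨ cong (_- (+ t₂ p k0 s - + t₁ p k0 s)) 2h≡p+1 ⟩
    + p + + 1 - (+ t₂ p k0 s - + t₁ p k0 s) ∎
    where
    open ≡-Reasoning
    h : ℤ
    h = halfp1 p
    regroup : ∀ a b h → a - (b - h) + h ≡ h + h - (b - a)
    regroup = solve-∀

  θ-index : ℕ → ℤ → ℤ
  θ-index k ℓ = kb p k0 k + + 1 - + δ p k0 s - ℓ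

  θ-index≡pred+1 : ∀ k ℓ → θ-index k ℓ ≡ kb p k0 k - + δ p k0 s - ℓ + + 1
  θ-index≡pred+1 k ℓ = shift (kb p k0 k) (+ δ p k0 s) ℓ
    where
    shift : ∀ K D L → K + + 1 - D - L ≡ K - D - L + + 1
    shift = solve-∀

  θ≡t₂-t₁ : ∀ k ℓ → Even (θ-index k ℓ) → θ p k0 s k ℓ ≡ + t₂ p k0 s - + t₁ p k0 s
  θ≡t₂-t₁ k ℓ = β-step≡t₂-t₁ (kb p k0 k - + δ p k0 s - ℓ) (θ-index k ℓ) (θ-index≡pred+1 k ℓ)

  θ≡p+1-[t₂-t₁] : halfp1 p + halfp1 p ≡ + p + + 1 → ∀ k ℓ → Odd (θ-index k ℓ) →
    θ p k0 s k ℓ ≡ + p + + 1 - (+ t₂ p k0 s - + t₁ p k0 s)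
  θ≡p+1-[t₂-t₁] 2h≡p+1 k ℓ = β-step≡p+1-[t₂-t₁] (kb p k0 k - + δ p k0 s - ℓ) (θ-index k ℓ) 2h≡p+1 (θ-index≡pred+1 k ℓ)

  δ-t-when-a+s<p-1 : a p k0 s ℕ.+ s < pm1 p → pm1 p ≤ s ℕ.+ (a p k0 s ℕ.+ s) →
    δ p k0 s ≡ 1 × t₁ p k0 s ≡ s ℕ.+ 1 × t₂ p k0 s ≡ a p k0 s ℕ.+ s ℕ.+ 1 ℕ.+ 2
  δ-t-when-a+s<p-1 a+s<d d≤s+a+s = δ≡1
    , trans (if-cong unwrapped) (cong (s ℕ.+_) δ≡1)
    , trans (if-cong unwrapped) (cong (λ d → a p k0 s ℕ.+ s ℕ.+ d ℕ.+ 2) δ≡1)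
    where
    unwrapped : ((a p k0 s ℕ.+ s) ℕ.<ᵇ pm1 p) ≡ true
    unwrapped = dec-true (_ ℕ.<? _) a+s<d
    δ≡1 : δ p k0 s ≡ 1
    δ≡1 = if-cong (trans (cong (λ r → (s ℕ.+ r) ℕ.<ᵇ pm1 p) (ℕ.m<n⇒m%n≡m a+s<d))
                         (dec-false (_ ℕ.<? _) (ℕ.≤⇒≯ d≤s+a+s)))

  δ-t-when-a+s≡m+p-1 : ∀ m → a p k0 s ℕ.+ s ≡ m ℕ.+ pm1 p → s ℕ.+ m < pm1 p →
    δ p k0 s ≡ 0 × t₁ p k0 s ≡ m ℕ.+ 1 × t₂ p k0 s ≡ s ℕ.+ 1
  δ-t-when-a+s≡m+p-1 m a+s≡m+d s+m<d = δ≡0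
    , trans (if-cong wrapped) (trans (cong₂ (λ r d → r ℕ.+ d ℕ.+ 1) res≡m δ≡0) (cong (ℕ._+ 1) (ℕ.+-identityʳ m)))
    , trans (if-cong wrapped) (trans (cong (λ d → s ℕ.+ d ℕ.+ 1) δ≡0) (cong (ℕ._+ 1) (ℕ.+-identityʳ s)))
    where
    wrapped : ((a p k0 s ℕ.+ s) ℕ.<ᵇ pm1 p) ≡ false
    wrapped = dec-false (_ ℕ.<? _) (ℕ.≤⇒≯ (subst (pm1 p ≤_) (sym a+s≡m+d) (ℕ.m≤n+m (pm1 p) m)))
    res≡m : res p (+ (a p k0 s ℕ.+ s)) ≡ m
    res≡m = trans (cong (λ n → res p (+ n)) a+s≡m+d) (res-+pm1 p (ℕ.≤-<-trans (ℕ.m≤n+m m s) s+m<d))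
    δ≡0 : δ p k0 s ≡ 0
    δ≡0 = if-cong (trans (cong (λ r → (s ℕ.+ r) ℕ.<ᵇ pm1 p) res≡m) (dec-true (_ ℕ.<? _) s+m<d))

-- The two regimes of s

θᵉ : ℕ → ℕ → ℤ
θᵉ k0 s = + 2 * + s + + 2 - + k0

θᵒ : ℕ → ℕ → ℕ → ℤ
θᵒ p k0 s = + p - + 1 - + 2 * + s + + k0

p+1-θᵒ≡θᵉ : ∀ p k0 s → + p + + 1 - θᵒ p k0 s ≡ θᵉ k0 s
p+1-θᵒ≡θᵉ p k0 s = complement (+ p) (+ k0) (+ s)
  where
  complement : ∀ P K S → P + + 1 - (P - + 1 - + 2 * S + K) ≡ + 2 * S + + 2 - K
  complement = solve-∀

p+1-θᵉ≡θᵒ : ∀ p k0 s → + p + + 1 - θᵉ k0 s ≡ θᵒ p k0 s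
p+1-θᵉ≡θᵒ p k0 s = complement (+ p) (+ k0) (+ s)
  where
  complement : ∀ P K S → P + + 1 - (+ 2 * S + + 2 - K) ≡ P - + 1 - + 2 * S + K
  complement = solve-∀

-- s ≥ k₀ − 1 (where a_s + s < p − 1) and s ≤ k₀ − 2 (where a_s + s ≥ p − 1), parametrised
-- without truncated subtraction.
data NoWrap : ℕ → ℕ → ℕ → Set where
  no-wrap : ∀ u i w → NoWrap (4 ℕ.+ u ℕ.+ i ℕ.+ i ℕ.+ w) (2 ℕ.+ u) (1 ℕ.+ u ℕ.+ i)

data Wrap : ℕ → ℕ → ℕ → Set where
  wrap : ∀ r j w → let s = 3 ℕ.+ r ℕ.+ j; k0 = s ℕ.+ 2 ℕ.+ r in Wrap (k0 ℕ.+ w) k0 s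

NoWrap⇒δ≡1×t₂-t₁≡θᵒ : ∀ {p k0 s} → NoWrap p k0 s → δ p k0 s ≡ 1 × + t₂ p k0 s - + t₁ p k0 s ≡ θᵒ p k0 s
NoWrap⇒δ≡1×t₂-t₁≡θᵒ {p} {k0} {s} (no-wrap u i w) = δ≡1 , (begin
  + t₂ p k0 s - + t₁ p k0 s                         ≡⟨ cong₂ (λ x y → + x - + y) t₂≡ t₁≡ ⟩
  + (a p k0 s ℕ.+ s ℕ.+ 1 ℕ.+ 2) - + (s ℕ.+ 1)    ≡⟨ cong (λ x → + (x ℕ.+ s ℕ.+ 1 ℕ.+ 2) - + (s ℕ.+ 1)) a≡w+1 ⟩
  + (suc w ℕ.+ s ℕ.+ 1 ℕ.+ 2) - + (s ℕ.+ 1)       ≡⟨ gap (+ u) (+ i) (+ w) ⟩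
  θᵒ p k0 s                                         ∎)
  where
  open ≡-Reasoning
  -- Instantiated at + u, + i, … the integer identities below are the goals up to conversion,
  -- since _+_ computes on non-negative integers.
  k0-2-2s : ∀ U I → (+ 2 + U) - + 2 - + 2 * (+ 1 + U + I) ≡ - (+ 2 + U + I + I)
  k0-2-2s = solve-∀
  a≡w+1 : a p k0 s ≡ suc w
  a≡w+1 = trans (cong (res p) (k0-2-2s (+ u) (+ i))) (res-neg p (1 ℕ.+ u ℕ.+ i ℕ.+ i) w (sum u i w))
    where
    sum : ∀ u i w → 2 ℕ.+ u ℕ.+ i ℕ.+ i ℕ.+ suc w ≡ suc (2 ℕ.+ u ℕ.+ i ℕ.+ i ℕ.+ w)
    sum = ℕ-Solver.solve-∀
  a+s<d : a p k0 s ℕ.+ s < pm1 p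
  a+s<d rewrite a≡w+1 = m+n≡o⇒m≤o {n = i} (sum u i w)
    where
    sum : ∀ u i w → suc (suc w ℕ.+ (1 ℕ.+ u ℕ.+ i)) ℕ.+ i ≡ suc (2 ℕ.+ u ℕ.+ i ℕ.+ i ℕ.+ w)
    sum = ℕ-Solver.solve-∀
  d≤s+a+s : pm1 p ≤ s ℕ.+ (a p k0 s ℕ.+ s)
  d≤s+a+s rewrite a≡w+1 = m+n≡o⇒m≤o {n = u} (sum u i w)
    where
    sum : ∀ u i w → suc (2 ℕ.+ u ℕ.+ i ℕ.+ i ℕ.+ w) ℕ.+ u ≡ (1 ℕ.+ u ℕ.+ i) ℕ.+ (suc w ℕ.+ (1 ℕ.+ u ℕ.+ i))
    sum = ℕ-Solver.solve-∀
  unwrapped : δ p k0 s ≡ 1 × t₁ p k0 s ≡ s ℕ.+ 1 × t₂ p k0 s ≡ a p k0 s ℕ.+ s ℕ.+ 1 ℕ.+ 2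
  unwrapped = δ-t-when-a+s<p-1 p k0 s a+s<d d≤s+a+s
  δ≡1 : δ p k0 s ≡ 1
  δ≡1 = proj₁ unwrapped
  t₁≡ : t₁ p k0 s ≡ s ℕ.+ 1
  t₁≡ = proj₁ (proj₂ unwrapped)
  t₂≡ : t₂ p k0 s ≡ a p k0 s ℕ.+ s ℕ.+ 1 ℕ.+ 2
  t₂≡ = proj₂ (proj₂ unwrapped)
  gap : ∀ U I W → (+ 1 + W + (+ 1 + U + I) + + 1 + + 2) - (+ 1 + U + I + + 1)
                  ≡ (+ 4 + U + I + I + W) - + 1 - + 2 * (+ 1 + U + I) + (+ 2 + U)
  gap = solve-∀

Wrap⇒δ≡0×t₂-t₁≡θᵉ : ∀ {p k0 s} → Wrap p k0 s → δ p k0 s ≡ 0 × + t₂ p k0 s - + t₁ p k0 s ≡ θᵉ k0 s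
Wrap⇒δ≡0×t₂-t₁≡θᵉ {p} {k0} {s} (wrap r j w) = δ≡0 , (begin
  + t₂ p k0 s - + t₁ p k0 s      ≡⟨ cong₂ (λ x y → + x - + y) t₂≡ t₁≡ ⟩
  + (s ℕ.+ 1) - + (r ℕ.+ 1)      ≡⟨ gap (+ r) (+ j) ⟩
  θᵉ k0 s                        ∎)
  where
  open ≡-Reasoning
  k0-2-2s : ∀ R J → (+ 3 + R + J + + 2 + R) - + 2 - + 2 * (+ 3 + R + J) ≡ - (+ 3 + J)
  k0-2-2s = solve-∀
  a≡ : a p k0 s ≡ suc (r ℕ.+ r ℕ.+ w)
  a≡ = trans (cong (res p) (k0-2-2s (+ r) (+ j))) (res-neg p (2 ℕ.+ j) (r ℕ.+ r ℕ.+ w) (sum r j w))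
    where
    sum : ∀ r j w → 3 ℕ.+ j ℕ.+ suc (r ℕ.+ r ℕ.+ w) ≡ suc (suc (r ℕ.+ j ℕ.+ 2 ℕ.+ r ℕ.+ w))
    sum = ℕ-Solver.solve-∀
  a+s≡r+d : a p k0 s ℕ.+ s ≡ r ℕ.+ pm1 p
  a+s≡r+d rewrite a≡ = sum r j w
    where
    sum : ∀ r j w → suc (r ℕ.+ r ℕ.+ w) ℕ.+ (3 ℕ.+ r ℕ.+ j) ≡ r ℕ.+ suc (suc (r ℕ.+ j ℕ.+ 2 ℕ.+ r ℕ.+ w))
    sum = ℕ-Solver.solve-∀
  s+r<d : s ℕ.+ r < pm1 p
  s+r<d = m+n≡o⇒m≤o {n = w} (sum r j w)
    where
    sum : ∀ r j w → suc (3 ℕ.+ r ℕ.+ j ℕ.+ r) ℕ.+ w ≡ suc (suc (r ℕ.+ j ℕ.+ 2 ℕ.+ r ℕ.+ w))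
    sum = ℕ-Solver.solve-∀
  wrapped : δ p k0 s ≡ 0 × t₁ p k0 s ≡ r ℕ.+ 1 × t₂ p k0 s ≡ s ℕ.+ 1
  wrapped = δ-t-when-a+s≡m+p-1 p k0 s r a+s≡r+d s+r<d
  δ≡0 : δ p k0 s ≡ 0
  δ≡0 = proj₁ wrapped
  t₁≡ : t₁ p k0 s ≡ r ℕ.+ 1
  t₁≡ = proj₁ (proj₂ wrapped)
  t₂≡ : t₂ p k0 s ≡ s ℕ.+ 1
  t₂≡ = proj₂ (proj₂ wrapped)
  gap : ∀ R J → (+ 3 + R + J + + 1) - (R + + 1) ≡ + 2 * (+ 3 + R + J) + + 2 - (+ 3 + R + J + + 2 + R)
  gap = solve-∀

record ThetaFormula (p k0 s : ℕ) : Set where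
  field
    θ≡θᵉ : ∀ k ℓ → Even (kb p k0 k + + 1 - ℓ) → θ p k0 s k ℓ ≡ θᵉ k0 s
    θ≡θᵒ : ∀ k ℓ → Odd (kb p k0 k + + 1 - ℓ) → θ p k0 s k ℓ ≡ θᵒ p k0 s

open ThetaFormula

NoWrap⇒θ-formula : ∀ {p k0 s} → halfp1 p + halfp1 p ≡ + p + + 1 → NoWrap p k0 s → ThetaFormula p k0 s
NoWrap⇒θ-formula {p} {k0} {s} 2h≡p+1 nw = record { θ≡θᵉ = even ; θ≡θᵒ = odd }
  where
  open ≡-Reasoning
  δ≡1 : δ p k0 s ≡ 1
  δ≡1 = proj₁ (NoWrap⇒δ≡1×t₂-t₁≡θᵒ nw)
  gap≡θᵒ : + t₂ p k0 s - + t₁ p k0 s ≡ θᵒ p k0 s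
  gap≡θᵒ = proj₂ (NoWrap⇒δ≡1×t₂-t₁≡θᵒ nw)
  shift : ∀ K L → K + + 1 - L ≡ K + + 1 - + 1 - L + + 1
  shift = solve-∀
  Y≡i+1 : ∀ k ℓ → kb p k0 k + + 1 - ℓ ≡ θ-index p k0 s k ℓ + + 1
  Y≡i+1 k ℓ = trans (shift (kb p k0 k) ℓ) (cong (λ d → kb p k0 k + + 1 - + d - ℓ + + 1) (sym δ≡1))
  even : ∀ k ℓ → Even (kb p k0 k + + 1 - ℓ) → θ p k0 s k ℓ ≡ θᵉ k0 s
  even k ℓ e = begin
    θ p k0 s k ℓ                              ≡⟨ θ≡p+1-[t₂-t₁] p k0 s 2h≡p+1 k ℓ i-odd ⟩
    + p + + 1 - (+ t₂ p k0 s - + t₁ p k0 s)  ≡⟨ cong (λ g → + p + + 1 - g) gap≡θᵒ ⟩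
    + p + + 1 - θᵒ p k0 s                    ≡⟨ p+1-θᵒ≡θᵉ p k0 s ⟩
    θᵉ k0 s                                   ∎
    where
    i-odd : Odd (θ-index p k0 s k ℓ)
    i-odd = even-suc⇒odd (θ-index p k0 s k ℓ) (subst Even (Y≡i+1 k ℓ) e)
  odd : ∀ k ℓ → Odd (kb p k0 k + + 1 - ℓ) → θ p k0 s k ℓ ≡ θᵒ p k0 s
  odd k ℓ o = trans (θ≡t₂-t₁ p k0 s k ℓ i-even) gap≡θᵒ
    where
    i-even : Even (θ-index p k0 s k ℓ)
    i-even = odd-suc⇒even (θ-index p k0 s k ℓ) (λ e → o (subst Even (sym (Y≡i+1 k ℓ)) e))

Wrap⇒θ-formula : ∀ {p k0 s} → halfp1 p + halfp1 p ≡ + p + + 1 → Wrap p k0 s → ThetaFormula p k0 s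
Wrap⇒θ-formula {p} {k0} {s} 2h≡p+1 wr = record { θ≡θᵉ = even ; θ≡θᵒ = odd }
  where
  open ≡-Reasoning
  δ≡0 : δ p k0 s ≡ 0
  δ≡0 = proj₁ (Wrap⇒δ≡0×t₂-t₁≡θᵉ wr)
  gap≡θᵉ : + t₂ p k0 s - + t₁ p k0 s ≡ θᵉ k0 s
  gap≡θᵉ = proj₂ (Wrap⇒δ≡0×t₂-t₁≡θᵉ wr)
  shift : ∀ K L → K + + 1 - L ≡ K + + 1 - + 0 - L
  shift = solve-∀
  Y≡i : ∀ k ℓ → kb p k0 k + + 1 - ℓ ≡ θ-index p k0 s k ℓ
  Y≡i k ℓ = trans (shift (kb p k0 k) ℓ) (cong (λ d → kb p k0 k + + 1 - + d - ℓ) (sym δ≡0))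
  even : ∀ k ℓ → Even (kb p k0 k + + 1 - ℓ) → θ p k0 s k ℓ ≡ θᵉ k0 s
  even k ℓ e = trans (θ≡t₂-t₁ p k0 s k ℓ (subst Even (Y≡i k ℓ) e)) gap≡θᵉ
  odd : ∀ k ℓ → Odd (kb p k0 k + + 1 - ℓ) → θ p k0 s k ℓ ≡ θᵒ p k0 s
  odd k ℓ o = begin
    θ p k0 s k ℓ                              ≡⟨ θ≡p+1-[t₂-t₁] p k0 s 2h≡p+1 k ℓ (λ e → o (subst Even (sym (Y≡i k ℓ)) e)) ⟩
    + p + + 1 - (+ t₂ p k0 s - + t₁ p k0 s)  ≡⟨ cong (λ g → + p + + 1 - g) gap≡θᵉ ⟩
    + p + + 1 - θᵉ k0 s                      ≡⟨ p+1-θᵉ≡θᵒ p k0 s ⟩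
    θᵒ p k0 s                                 ∎

Wrap-view : ∀ {p k0 s} → s ℕ.+ 2 ≤ k0 → k0 ℕ.+ 1 ≤ 2 ℕ.* s → k0 ≤ p → Wrap p k0 s
Wrap-view {s = s} s+2≤k0 k0+1≤2s k0≤p with ℕ.m≤n⇒∃[o]m+o≡n s+2≤k0
... | r , refl with ℕ.m≤n⇒∃[o]m+o≡n (ℕ.+-cancelˡ-≤ s _ _ (subst₂ _≤_ (left s r) (right s) k0+1≤2s))
  where
  left : ∀ s r → s ℕ.+ 2 ℕ.+ r ℕ.+ 1 ≡ s ℕ.+ (3 ℕ.+ r)
  left = ℕ-Solver.solve-∀
  right : ∀ s → 2 ℕ.* s ≡ s ℕ.+ s
  right = ℕ-Solver.solve-∀
... | j , refl with ℕ.m≤n⇒∃[o]m+o≡n k0≤p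
... | w , refl = wrap r j w

NoWrap-view : ∀ {p k0 s} → 2 ≤ k0 → k0 < s ℕ.+ 2 → 2 ℕ.* s ℕ.+ 4 ≤ k0 ℕ.+ p → NoWrap p k0 s
NoWrap-view {p} {s = s} 2≤k0 k0<s+2 2s+4≤k0+p with ℕ.m≤n⇒∃[o]m+o≡n 2≤k0
... | u , refl with ℕ.m≤n⇒∃[o]m+o≡n (ℕ.+-cancelʳ-≤ 2 (suc u) s (subst (_≤ s ℕ.+ 2) (sym (ℕ.+-comm (suc u) 2)) k0<s+2))
... | i , refl with ℕ.m≤n⇒∃[o]m+o≡n (ℕ.+-cancelˡ-≤ (2 ℕ.+ u) _ _ (subst (_≤ 2 ℕ.+ u ℕ.+ p) (sum u i) 2s+4≤k0+p))
  where
  sum : ∀ u i → 2 ℕ.* (suc u ℕ.+ i) ℕ.+ 4 ≡ 2 ℕ.+ u ℕ.+ (4 ℕ.+ u ℕ.+ i ℕ.+ i)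
  sum = ℕ-Solver.solve-∀
... | w , refl = no-wrap u i w

regime : ∀ {p k0 s} → 2 ≤ k0 → k0 ≤ p → k0 ℕ.+ 1 ≤ 2 ℕ.* s → 2 ℕ.* s ℕ.+ 4 ≤ k0 ℕ.+ p →
  NoWrap p k0 s ⊎ Wrap p k0 s
regime {k0 = k0} {s} 2≤k0 k0≤p k0+1≤2s 2s+4≤k0+p with s ℕ.+ 2 ℕ.≤? k0
... | yes s+2≤k0 = inj₂ (Wrap-view s+2≤k0 k0+1≤2s k0≤p)
... | no s+2≰k0  = inj₁ (NoWrap-view 2≤k0 (ℕ.≰⇒> s+2≰k0) 2s+4≤k0+p)

θ-formula : ∀ {p k0 s} → halfp1 p + halfp1 p ≡ + p + + 1 → 2 ≤ k0 → k0 ≤ p →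
  k0 ℕ.+ 1 ≤ 2 ℕ.* s × 2 ℕ.* s ℕ.+ 4 ≤ k0 ℕ.+ p → ThetaFormula p k0 s
θ-formula 2h≡p+1 2≤k0 k0≤p (k0+1≤2s , 2s+4≤k0+p) with regime 2≤k0 k0≤p k0+1≤2s 2s+4≤k0+p
... | inj₁ nw = NoWrap⇒θ-formula 2h≡p+1 nw
... | inj₂ wr = Wrap⇒θ-formula 2h≡p+1 wr

-- Range and monotonicity

m/2≤n⇒m≤1+2n : ∀ m n → m ℕ./ 2 ≤ n → m ≤ suc (2 ℕ.* n)
m/2≤n⇒m≤1+2n m n m/2≤n = begin
  m                        ≡⟨ ℕ.m≡m%n+[m/n]*n m 2 ⟩
  m ℕ.% 2 ℕ.+ m ℕ./ 2 ℕ.* 2 ≤⟨ ℕ.+-mono-≤ (ℕ.≤-pred (ℕ.m%n<n m 2)) (ℕ.*-monoˡ-≤ 2 m/2≤n) ⟩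
  1 ℕ.+ n ℕ.* 2            ≡⟨ cong suc (ℕ.*-comm n 2) ⟩
  suc (2 ℕ.* n)            ∎
  where open ℕ.≤-Reasoning

m≤n/2⇒2m≤n : ∀ m n → m ≤ n ℕ./ 2 → 2 ℕ.* m ≤ n
m≤n/2⇒2m≤n m n m≤n/2 = begin
  2 ℕ.* m        ≡⟨ ℕ.*-comm 2 m ⟩
  m ℕ.* 2        ≤⟨ ℕ.*-monoˡ-≤ 2 m≤n/2 ⟩
  n ℕ./ 2 ℕ.* 2  ≤⟨ ℕ.m/n*n≤m n 2 ⟩
  n              ∎
  where open ℕ.≤-Reasoning

InS⇒range : ∀ {p k0 s} → 4 ≤ k0 ℕ.+ p → InS p k0 s → k0 ℕ.+ 1 ≤ 2 ℕ.* s × 2 ℕ.* s ℕ.+ 4 ≤ k0 ℕ.+ p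
InS⇒range {p} {k0} {s} 4≤k0+p (lo , hi) =
  ℕ.≤-pred (subst (_≤ suc (2 ℕ.* s)) (ℕ.+-suc k0 1) (m/2≤n⇒m≤1+2n (k0 ℕ.+ 2) s lo)) ,
  ℕ.m≤o∸n⇒m+n≤o (2 ℕ.* s) 4≤k0+p (m≤n/2⇒2m≤n s (k0 ℕ.+ p ℕ.∸ 4) hi)

3≤θᵉ : ∀ k0 s → k0 ℕ.+ 1 ≤ 2 ℕ.* s → + 3 ≤ℤ θᵉ k0 s
3≤θᵉ k0 s k0+1≤2s with ℕ.m≤n⇒∃[o]m+o≡n k0+1≤2s
... | j , k0+1+j≡2s = subst (+ 3 ≤ℤ_) (sym θᵉ≡3+j) (ℤ.i≤i+j (+ 3) (+ j))
  where
  open ≡-Reasoning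
  cancel : ∀ K J → K + + 1 + J + + 2 - K ≡ + 3 + J
  cancel = solve-∀
  θᵉ≡3+j : θᵉ k0 s ≡ + 3 + + j
  θᵉ≡3+j = begin
    + 2 * + s + + 2 - + k0          ≡⟨ cong (λ x → x + + 2 - + k0) (sym (ℤ.pos-* 2 s)) ⟩
    + (2 ℕ.* s) + + 2 - + k0        ≡⟨ cong (λ n → + n + + 2 - + k0) (sym k0+1+j≡2s) ⟩
    + k0 + + 1 + + j + + 2 - + k0   ≡⟨ cancel (+ k0) (+ j) ⟩
    + 3 + + j                       ∎

3≤θᵒ : ∀ p k0 s → 2 ℕ.* s ℕ.+ 4 ≤ k0 ℕ.+ p → + 3 ≤ℤ θᵒ p k0 s
3≤θᵒ p k0 s 2s+4≤k0+p with ℕ.m≤n⇒∃[o]m+o≡n 2s+4≤k0+p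
... | y , 2s+4+y≡k0+p = subst (+ 3 ≤ℤ_) (sym θᵒ≡3+y) (ℤ.i≤i+j (+ 3) (+ y))
  where
  open ≡-Reasoning
  regroup : ∀ P K T → P - + 1 - T + K ≡ K + P - + 1 - T
  regroup = solve-∀
  cancel : ∀ T Y → T + + 4 + Y - + 1 - T ≡ + 3 + Y
  cancel = solve-∀
  θᵒ≡3+y : θᵒ p k0 s ≡ + 3 + + y
  θᵒ≡3+y = begin
    + p - + 1 - + 2 * + s + + k0                     ≡⟨ cong (λ x → + p - + 1 - x + + k0) (sym (ℤ.pos-* 2 s)) ⟩
    + p - + 1 - + (2 ℕ.* s) + + k0                   ≡⟨ regroup (+ p) (+ k0) (+ (2 ℕ.* s)) ⟩
    + (k0 ℕ.+ p) - + 1 - + (2 ℕ.* s)                 ≡⟨ cong (λ n → + n - + 1 - + (2 ℕ.* s)) (sym 2s+4+y≡k0+p) ⟩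
    + (2 ℕ.* s) + + 4 + + y - + 1 - + (2 ℕ.* s)      ≡⟨ cancel (+ (2 ℕ.* s)) (+ y) ⟩
    + 3 + + y                                        ∎

≤p-2 : ∀ p {x y} → + p + + 1 - y ≡ x → + 3 ≤ℤ y → x ≤ℤ + p - + 2
≤p-2 p p+1-y≡x 3≤y =
  subst₂ _≤ℤ_ p+1-y≡x (p+1-3 (+ p)) (ℤ.+-monoʳ-≤ (+ p + + 1) (ℤ.neg-mono-≤ 3≤y))
  where
  p+1-3 : ∀ P → P + + 1 - + 3 ≡ P - + 2
  p+1-3 = solve-∀

θᵉ-range : ∀ p k0 s → k0 ℕ.+ 1 ≤ 2 ℕ.* s → 2 ℕ.* s ℕ.+ 4 ≤ k0 ℕ.+ p →
  + 3 ≤ℤ θᵉ k0 s × θᵉ k0 s ≤ℤ + p - + 2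
θᵉ-range p k0 s k0+1≤2s 2s+4≤k0+p =
  3≤θᵉ k0 s k0+1≤2s , ≤p-2 p (p+1-θᵒ≡θᵉ p k0 s) (3≤θᵒ p k0 s 2s+4≤k0+p)

θᵒ-range : ∀ p k0 s → k0 ℕ.+ 1 ≤ 2 ℕ.* s → 2 ℕ.* s ℕ.+ 4 ≤ k0 ℕ.+ p →
  + 3 ≤ℤ θᵒ p k0 s × θᵒ p k0 s ≤ℤ + p - + 2
θᵒ-range p k0 s k0+1≤2s 2s+4≤k0+p =
  3≤θᵒ p k0 s 2s+4≤k0+p , ≤p-2 p (p+1-θᵉ≡θᵒ p k0 s) (3≤θᵉ k0 s k0+1≤2s)

θ-range : ∀ {p k0 s} → ThetaFormula p k0 s → k0 ℕ.+ 1 ≤ 2 ℕ.* s × 2 ℕ.* s ℕ.+ 4 ≤ k0 ℕ.+ p →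
  ∀ k ℓ → + 3 ≤ℤ θ p k0 s k ℓ × θ p k0 s k ℓ ≤ℤ + p - + 2
θ-range {p} {k0} {s} formula (k0+1≤2s , 2s+4≤k0+p) k ℓ with even? (kb p k0 k + + 1 - ℓ)
... | yes e = subst (λ x → + 3 ≤ℤ x × x ≤ℤ + p - + 2) (sym (θ≡θᵉ formula k ℓ e)) (θᵉ-range p k0 s k0+1≤2s 2s+4≤k0+p)
... | no o  = subst (λ x → + 3 ≤ℤ x × x ≤ℤ + p - + 2) (sym (θ≡θᵒ formula k ℓ o)) (θᵒ-range p k0 s k0+1≤2s 2s+4≤k0+p)

θᵉ-<-mono : ∀ k0 {s s′} → s < s′ → θᵉ k0 s ℤ.< θᵉ k0 s′
θᵉ-<-mono k0 s<s′ = ℤ.+-monoˡ-< (- + k0) (ℤ.+-monoˡ-< (+ 2) (ℤ.*-monoˡ-<-pos (+ 2) (ℤ.+<+ s<s′)))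

θᵒ-<-antimono : ∀ p k0 {s s′} → s < s′ → θᵒ p k0 s′ ℤ.< θᵒ p k0 s
θᵒ-<-antimono p k0 s<s′ =
  ℤ.+-monoˡ-< (+ k0) (ℤ.+-monoʳ-< (+ p - + 1) (ℤ.neg-mono-< (ℤ.*-monoˡ-<-pos (+ 2) (ℤ.+<+ s<s′))))

half-<-antimono : ∀ x {u v} → v ℤ.< u → mkℚᵘ (x - u) 1 <ℚ mkℚᵘ (x - v) 1
half-<-antimono x v<u = *<* (ℤ.*-monoʳ-<-pos (+ 2) (ℤ.+-monoʳ-< x (ℤ.neg-mono-< v<u)))

ℓ-index-suc : ∀ K ℓ → K + + 1 - ℓ ≡ K + + 1 - (ℓ + + 1) + + 1
ℓ-index-suc = solve-∀

B-<-mono : ∀ {p k0 s s′} k ℓ → ThetaFormula p k0 s → ThetaFormula p k0 s′ →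
  Even (kb p k0 k + + 1 - ℓ) → s < s′ → B p k0 s k ℓ <ℚ B p k0 s′ k ℓ
B-<-mono {p} {k0} k ℓ formula formula′ e s<s′ =
  half-<-antimono (+ k - + 2 + + (p ℕ.+ 1) * ℓ) (subst₂ ℤ._<_
    (sym (θ≡θᵒ formula′ k (ℓ + + 1) odd)) (sym (θ≡θᵒ formula k (ℓ + + 1) odd))
    (θᵒ-<-antimono p k0 s<s′))
  where
  odd : Odd (kb p k0 k + + 1 - (ℓ + + 1))
  odd = even-suc⇒odd (kb p k0 k + + 1 - (ℓ + + 1)) (subst Even (ℓ-index-suc (kb p k0 k) ℓ) e)

B-<-antimono : ∀ {p k0 s s′} k ℓ → ThetaFormula p k0 s → ThetaFormula p k0 s′ →
  Odd (kb p k0 k + + 1 - ℓ) → s < s′ → B p k0 s′ k ℓ <ℚ B p k0 s k ℓ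
B-<-antimono {p} {k0} k ℓ formula formula′ o s<s′ =
  half-<-antimono (+ k - + 2 + + (p ℕ.+ 1) * ℓ) (subst₂ ℤ._<_
    (sym (θ≡θᵉ formula k (ℓ + + 1) even)) (sym (θ≡θᵉ formula′ k (ℓ + + 1) even))
    (θᵉ-<-mono k0 s<s′))
  where
  even : Even (kb p k0 k + + 1 - (ℓ + + 1))
  even = odd-suc⇒even (kb p k0 k + + 1 - (ℓ + + 1)) (λ e → o (subst Even (sym (ℓ-index-suc (kb p k0 k) ℓ)) e))

lemma4p3 : (p k0 : ℕ) → Prime p → 7 ≤ p → 2 ≤ k0 → k0 ≤ p →
    (k : ℕ) → InK p k0 k → (ℓ : ℤ) →
    ((s : ℕ) → InS p k0 s →
      (Even (kb p k0 k + + 1 - ℓ) → θ p k0 s k ℓ ≡ + 2 * + s + + 2 - + k0)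
      × (Odd (kb p k0 k + + 1 - ℓ) → θ p k0 s k ℓ ≡ + p - + 1 - + 2 * + s + + k0)
      × (+ 3 ≤ℤ θ p k0 s k ℓ × θ p k0 s k ℓ ≤ℤ + p - + 2))
    × (Even (kb p k0 k + + 1 - ℓ) → (s s′ : ℕ) → InS p k0 s → InS p k0 s′ →
        s < s′ → B p k0 s k ℓ <ℚ B p k0 s′ k ℓ)
    × (Odd (kb p k0 k + + 1 - ℓ) → (s s′ : ℕ) → InS p k0 s → InS p k0 s′ →
        s < s′ → B p k0 s′ k ℓ <ℚ B p k0 s k ℓ)
lemma4p3 p k0 p-prime 7≤p 2≤k0 k0≤p k _ ℓ =
  (λ s s∈S → θ≡θᵉ (formula s∈S) k ℓ , θ≡θᵒ (formula s∈S) k ℓ , θ-range (formula s∈S) (range s∈S) k ℓ) ,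
  (λ e s s′ s∈S s′∈S → B-<-mono k ℓ (formula s∈S) (formula s′∈S) e) ,
  (λ o s s′ s∈S s′∈S → B-<-antimono k ℓ (formula s∈S) (formula s′∈S) o)
  where
  range : ∀ {s} → InS p k0 s → k0 ℕ.+ 1 ≤ 2 ℕ.* s × 2 ℕ.* s ℕ.+ 4 ≤ k0 ℕ.+ p
  range = InS⇒range (ℕ.≤-trans (ℕ.≤-trans (ℕ.m≤m+n 4 3) 7≤p) (ℕ.m≤n+m p k0))
  formula : ∀ {s} → InS p k0 s → ThetaFormula p k0 s
  formula s∈S = θ-formula (halfp1-double (prime⇒odd p-prime (ℕ.≤-trans (ℕ.m≤m+n 3 4) 7≤p))) 2≤k0 k0≤p (range s∈S)
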